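{- For $n\ge 1$, the polynomials $\widehat{A}_n(t,q)$ satisfy $$2\widehat{A}_{n+1}(t,q)=(1+tq)\widehat{A}_n(tq,q)+(1+tq^n)\widehat{A}_n(t,q)+\sum_{i=1}^{n-1}(1+t^2q^{2i+1})\binom{n}{i}\widehat{A}_i(t,q)\widehat{A}_{n-i}(tq^{i+1},q),$$ with $\widehat{A}_1(t,q)=1$.
   Context: For $\pi=\pi_1\cdots\pi_n\in\mathfrak{S}_n$ (permutations of $\{1,\dots,n\}$), the alternating descent set is $\widehat{D}(\pi)=\{2i\in[n-1]: \pi_{2i}<\pi_{2i+1}\}\cup\{2i+1\in[n-1]: \pi_{2i+1}>\pi_{2i+2}\}$, $\mathrm{altdes}(\pi)=|\widehat{D}(\pi)|$ and $\mathrm{altmaj}(\pi)=\sum_{i\in\widehat{D}(\pi)}i$. $\widehat{A}_n(t,q)=\sum_{\pi\in\mathfrak{S}_n}t^{\mathrm{altdes}(\pi)}q^{\mathrm{altmaj}(\pi)}$. -}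

module Defs where

open import Level using (Level)
open import Data.Bool using (Bool; true; false; if_then_else_)
open import Data.Nat using (ℕ; zero; suc; _<ᵇ_)
open import Data.Fin using (Fin; toℕ; _≟_)
open import Data.List using (List; []; _∷_; _++_; map; concatMap; filter; allFin; length; foldr; upTo)
import Data.List as L
import Data.Nat.ListAction as LA
import Data.List.Relation.Unary.Unique.DecPropositional as UD
open import Algebra.Bundles using (CommutativeSemiring)
import Algebra.Definitions.RawSemiring as RS

words : ℕ → (n : ℕ) → List (List (Fin n))
words zero    n = [] ∷ []
words (suc k) n = concatMap (λ x → map (x ∷_) (words k n)) (allFin n)

-- 𝔖_n : permutations of {1..n} in one-line notation, i.e. the words of
-- length n over an n-letter alphabet with pairwise distinct letters
-- (letter j : Fin n stands for the value j+1).
perms : (n : ℕ) → List (List (Fin n))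
perms n = filter (UD.unique? (_≟_ {n = n})) (words n n)

isEven : ℕ → Bool
isEven zero          = true
isEven (suc zero)    = false
isEven (suc (suc i)) = isEven i

altCond : ∀ {n} → ℕ → Fin n → Fin n → Bool
altCond i a b = if isEven i then toℕ a <ᵇ toℕ b else toℕ b <ᵇ toℕ a

altD : ∀ {n} → ℕ → List (Fin n) → List ℕ
altD i (a ∷ b ∷ rest) = (if altCond i a b then i ∷ [] else []) ++ altD (suc i) (b ∷ rest)
altD i _              = []

altDesSet : ∀ {n} → List (Fin n) → List ℕ
altDesSet π = altD 1 π

altdes : ∀ {n} → List (Fin n) → ℕ
altdes π = length (altDesSet π)

altmaj : ∀ {n} → List (Fin n) → ℕ
altmaj π = LA.sum (altDesSet π)

module _ {c ℓ : Level} (R : CommutativeSemiring c ℓ) where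
  open CommutativeSemiring R
  open RS rawSemiring using (_^_; _×_)

  sumR : List Carrier → Carrier
  sumR = foldr _+_ 0#

  Ahat : ℕ → Carrier → Carrier → Carrier
  Ahat n t q = sumR (map (λ π → (t ^ altdes π) * (q ^ altmaj π)) (perms n))

  sumFrom1 : ℕ → (ℕ → Carrier) → Carrier
  sumFrom1 n f = sumR (map f (L.drop 1 (upTo n)))

  powR : Carrier → ℕ → Carrier
  powR x k = x ^ k

  natMul : ℕ → Carrier → Carrier
  natMul k x = k × x

-- Let Â⁽ᵒ⁾ₙ count alternating descents with the parity of every position shifted by o.
-- Complementing the letters of a permutation interchanges ascents and descents, so
-- Â⁽¹⁾ₙ = Â⁽⁰⁾ₙ = Âₙ and 2Âₙ₊₁ = Â⁽⁰⁾ₙ₊₁ + Â⁽¹⁾ₙ₊₁.  A permutation of {0,…,n} is σ 0 τ, where σ and τ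
-- arrange an i-subset S of {1,…,n} and its complement.  Its weight is the weight of σ, times the
-- weights of the two steps next to 0, times the weight of τ read from position i+2; moving τ back
-- to position 1 replaces t by t q^(i+1) and the offset o by o+i+1.  Relabelling S and its
-- complement order-preservingly, the sum over σ and τ is Âᵢ(t) Âₙ₋ᵢ(t q^(i+1)) times the two step
-- weights, and over both offsets these add up to 1 + t q (i = 0), 1 + t qⁿ (i = n) or
-- 1 + t² q^(2i+1) (0 < i < n), for each of the (n choose i) subsets S.
module Submission where

open import Defs
open import Data.Nat using (ℕ; suc; _≤_)
import Data.Nat as ℕ
open import Data.Nat.Combinatorics using (_C_)
open import Data.Product using (_×_)
open import Algebra.Bundles using (CommutativeSemiring)

open import Level using (Level)
open import Function using (_∘_; id)
open import Data.Empty using (⊥-elim)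
open import Data.Bool using (Bool; true; false; not; if_then_else_)
open import Data.Nat using (zero; _<_; _<ᵇ_; _∸_)
import Data.Nat.ListAction as ℕ
import Data.Nat.Properties as ℕ
open import Data.Nat.Combinatorics using (nCn≡1; nCk+nC[k+1]≡[n+1]C[k+1]; k>n⇒nCk≡0)
open import Data.Fin as Fin using (Fin; toℕ; opposite; _≟_)
import Data.Fin.Properties as Fin
open import Data.Product as Product using (_,_; proj₁; proj₂)
open import Data.List
  using (List; []; _∷_; [_]; _++_; map; concatMap; filter; length; lookup; allFin; tabulate; upTo; downFrom; applyUpTo; drop)
import Data.List.Properties as List
open import Data.List.Relation.Unary.All as All using (All; []; _∷_)
import Data.List.Relation.Unary.All.Properties as All
open import Data.List.Relation.Unary.AllPairs using (AllPairs; []; _∷_)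
import Data.List.Relation.Unary.AllPairs.Properties as AllPairs
open import Data.List.Relation.Unary.Any using (here; there)
import Data.List.Relation.Unary.Unique.DecPropositional as Unique
import Data.List.Relation.Unary.Unique.Propositional.Properties as Unique
open import Data.List.Membership.Propositional using (_∉_)
open import Data.List.Membership.Propositional.Properties using (∈-lookup)
open import Data.List.Relation.Binary.Sublist.Propositional using (_⊆_; []; _∷_; _∷ʳ_)
open import Data.List.Relation.Binary.Sublist.Propositional.Properties using (All-resp-⊆)
open import Data.List.Relation.Binary.Permutation.Propositional as ↭ using (_↭_; prep; swap)
import Data.List.Relation.Binary.Permutation.Propositional.Properties as ↭
open import Relation.Nullary using (¬_; Dec; yes; no; does; ¬?)
open import Relation.Nullary.Decidable using (_×-dec_)
open import Relation.Nullary.Reflects using (ofʸ; ofⁿ)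
open import Relation.Unary using (Pred; Decidable)
open import Relation.Binary using (tri<; tri≈; tri>)
open import Algebra.Bundles using (CommutativeMonoid)
open import Relation.Binary.PropositionalEquality as ≡ using (_≡_)

private
  variable
    a p r : Level
    A B : Set a

-- Arrangements and splittings of a list

select : List A → List (A × List A)
select []       = []
select (x ∷ xs) = (x , xs) ∷ map (Product.map₂ (x ∷_)) (select xs)

arrangements : ℕ → List A → List (List A)
arrangements zero    xs = [ [] ]
arrangements (suc k) xs = concatMap (λ (y , ys) → map (y ∷_) (arrangements k ys)) (select xs)

permutations : List A → List (List A)
permutations xs = arrangements (length xs) xs

splits : List A → List (List A × List A)
splits []       = [ ([] , []) ]
splits (x ∷ xs) = map (Product.map₁ (x ∷_)) (splits xs) ++ map (Product.map₂ (x ∷_)) (splits xs)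

select-map : (f : A → B) (xs : List A) → select (map f xs) ≡ map (Product.map f (map f)) (select xs)
select-map f []       = ≡.refl
select-map f (x ∷ xs) = ≡.cong ((f x , map f xs) ∷_) (begin
  map (Product.map₂ (f x ∷_)) (select (map f xs))
    ≡⟨ ≡.cong (map _) (select-map f xs) ⟩
  map (Product.map₂ (f x ∷_)) (map (Product.map f (map f)) (select xs))
    ≡⟨ List.map-∘ (select xs) ⟨
  map (Product.map f (map f) ∘ Product.map₂ (x ∷_)) (select xs)
    ≡⟨ List.map-∘ (select xs) ⟩
  map (Product.map f (map f)) (map (Product.map₂ (x ∷_)) (select xs)) ∎)
  where open ≡.≡-Reasoning

arrangements-map : (f : A → B) (k : ℕ) (xs : List A) →
  arrangements k (map f xs) ≡ map (map f) (arrangements k xs)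
arrangements-map f zero    xs = ≡.refl
arrangements-map f (suc k) xs = begin
  concatMap extend (select (map f xs))                        ≡⟨ ≡.cong (concatMap extend) (select-map f xs) ⟩
  concatMap extend (map (Product.map f (map f)) (select xs)) ≡⟨ List.concatMap-map extend _ (select xs) ⟩
  concatMap (extend ∘ Product.map f (map f)) (select xs)
    ≡⟨ List.concatMap-cong (λ (y , ys) → ≡.trans (≡.cong (map (f y ∷_)) (arrangements-map f k ys))
                                                 (≡.sym (List.map-∘ (arrangements k ys)))) (select xs) ⟩
  concatMap (λ (y , ys) → map (map f ∘ (y ∷_)) (arrangements k ys)) (select xs)
    ≡⟨ List.concatMap-cong (λ (y , ys) → List.map-∘ (arrangements k ys)) (select xs) ⟩
  concatMap (map (map f) ∘ λ (y , ys) → map (y ∷_) (arrangements k ys)) (select xs)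
    ≡⟨ List.map-concatMap (map f) _ (select xs) ⟨
  map (map f) (arrangements (suc k) xs) ∎
  where
  open ≡.≡-Reasoning
  extend : _ × List _ → List (List _)
  extend (y , ys) = map (y ∷_) (arrangements k ys)

select-length : (xs : List A) → All (λ (_ , ys) → length xs ≡ suc (length ys)) (select xs)
select-length []       = []
select-length (x ∷ xs) = ≡.refl ∷ All.map⁺ (All.map (≡.cong suc) (select-length xs))

splits-⊆ : (xs : List A) →
  All (λ (S , T) → S ⊆ xs × T ⊆ xs × length S ℕ.+ length T ≡ length xs) (splits xs)
splits-⊆ []       = ([] , [] , ≡.refl) ∷ []
splits-⊆ (x ∷ xs) = All.++⁺
  (All.map⁺ (All.map (λ (S⊆ , T⊆ , len) → ≡.refl ∷ S⊆ , x ∷ʳ T⊆ , ≡.cong suc len) (splits-⊆ xs)))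
  (All.map⁺ (All.map (λ {(S , T)} (S⊆ , T⊆ , len) →
     x ∷ʳ S⊆ , ≡.refl ∷ T⊆ , ≡.trans (ℕ.+-suc (length S) (length T)) (≡.cong suc len)) (splits-⊆ xs)))

AllPairs-resp-⊆ : {R : A → A → Set r} {xs ys : List A} → xs ⊆ ys → AllPairs R ys → AllPairs R xs
AllPairs-resp-⊆ []         []         = []
AllPairs-resp-⊆ (_ ∷ʳ xs⊆) (_ ∷ pys)  = AllPairs-resp-⊆ xs⊆ pys
AllPairs-resp-⊆ (≡.refl ∷ xs⊆) (py ∷ pys) = All-resp-⊆ xs⊆ py ∷ AllPairs-resp-⊆ xs⊆ pys

select-All : {P : A → Set p} {xs : List A} → All P xs → All (λ (y , ys) → P y × All P ys) (select xs)
select-All []         = []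
select-All (px ∷ pxs) = (px , pxs) ∷ All.map⁺ (All.map (λ (py , pys) → py , px ∷ pys) (select-All pxs))

arrangements-All : {P : A → Set p} (k : ℕ) {xs : List A} → All P xs →
  All (λ w → All P w × length w ≡ k) (arrangements k xs)
arrangements-All zero    pxs = ([] , ≡.refl) ∷ []
arrangements-All (suc k) pxs = All.concat⁺ (All.map⁺ (All.map
  (λ (py , pys) → All.map⁺ (All.map (λ (pw , len) → py ∷ pw , ≡.cong suc len) (arrangements-All k pys)))
  (select-All pxs)))

-- Permutations as arrangements

filter-concatMap : {P : Pred B p} (P? : Decidable P) (f : A → List B) (xs : List A) →
  filter P? (concatMap f xs) ≡ concatMap (filter P? ∘ f) xs
filter-concatMap P? f []       = ≡.refl
filter-concatMap P? f (x ∷ xs) =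
  ≡.trans (List.filter-++ P? (f x) (concatMap f xs)) (≡.cong (filter P? (f x) ++_) (filter-concatMap P? f xs))

concatMap-filter : {P : Pred A p} (P? : Decidable P) (f : A → List B) (xs : List A) →
  concatMap (λ x → if does (P? x) then f x else []) xs ≡ concatMap f (filter P? xs)
concatMap-filter P? f []       = ≡.refl
concatMap-filter P? f (x ∷ xs) with does (P? x)
... | true  = ≡.cong (f x ++_) (concatMap-filter P? f xs)
... | false = concatMap-filter P? f xs

filter-filter : {P Q : Pred A p} (P? : Decidable P) (Q? : Decidable Q) (xs : List A) →
  filter P? (filter Q? xs) ≡ filter (λ x → Q? x ×-dec P? x) xs
filter-filter P? Q? []       = ≡.refl
filter-filter {P = P} {Q} P? Q? (y ∷ xs) = by-cases (Q? y) (P? y)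
  where
  open ≡.≡-Reasoning
  PQ? = λ x → Q? x ×-dec P? x
  by-cases : Dec (Q y) → Dec (P y) → filter P? (filter Q? (y ∷ xs)) ≡ filter PQ? (y ∷ xs)
  by-cases (yes q) (yes p) = begin
    filter P? (filter Q? (y ∷ xs))  ≡⟨ ≡.cong (filter P?) (List.filter-accept Q? q) ⟩
    filter P? (y ∷ filter Q? xs)    ≡⟨ List.filter-accept P? p ⟩
    y ∷ filter P? (filter Q? xs)    ≡⟨ ≡.cong (y ∷_) (filter-filter P? Q? xs) ⟩
    y ∷ filter PQ? xs               ≡⟨ List.filter-accept PQ? (q , p) ⟨
    filter PQ? (y ∷ xs)             ∎
  by-cases (yes q) (no ¬p) = begin
    filter P? (filter Q? (y ∷ xs))  ≡⟨ ≡.cong (filter P?) (List.filter-accept Q? q) ⟩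
    filter P? (y ∷ filter Q? xs)    ≡⟨ List.filter-reject P? ¬p ⟩
    filter P? (filter Q? xs)        ≡⟨ filter-filter P? Q? xs ⟩
    filter PQ? xs                   ≡⟨ List.filter-reject PQ? (¬p ∘ proj₂) ⟨
    filter PQ? (y ∷ xs)             ∎
  by-cases (no ¬q) _ = begin
    filter P? (filter Q? (y ∷ xs))  ≡⟨ ≡.cong (filter P?) (List.filter-reject Q? ¬q) ⟩
    filter P? (filter Q? xs)        ≡⟨ filter-filter P? Q? xs ⟩
    filter PQ? xs                   ≡⟨ List.filter-reject PQ? (¬q ∘ proj₁) ⟨
    filter PQ? (y ∷ xs)             ∎

module _ {n : ℕ} where
  open import Data.List.Membership.DecPropositional (_≟_ {n = n}) using (_∈?_)

  _∉?_ : (x : Fin n) (U : List (Fin n)) → Dec (x ∉ U)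
  x ∉? U = ¬? (x ∈? U)

  _≢?_ : (x y : Fin n) → Dec (¬ x ≡ y)
  x ≢? y = ¬? (x ≟ y)

  Fresh : List (Fin n) → List (Fin n) → Set
  Fresh U w = Unique.Unique _≟_ w × All (_∉ U) w

  fresh? : (U : List (Fin n)) → Decidable (Fresh U)
  fresh? U w = Unique.unique? _≟_ w ×-dec All.all? (_∉? U) w

  fresh-∷⁻ : ∀ {U x w} → Fresh U (x ∷ w) → Fresh (x ∷ U) w
  fresh-∷⁻ (x∉w ∷ uw , _ ∷ w∉U) =
    uw , All.zipWith (λ (x≢y , y∉U) → λ { (here y≡x) → x≢y (≡.sym y≡x) ; (there y∈U) → y∉U y∈U }) (x∉w , w∉U)

  fresh-∷⁺ : ∀ {U x w} → x ∉ U → Fresh (x ∷ U) w → Fresh U (x ∷ w)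
  fresh-∷⁺ x∉U (uw , w∉xU) =
    All.map (λ y∉xU x≡y → y∉xU (here (≡.sym x≡y))) w∉xU ∷ uw , x∉U ∷ All.map (λ y∉xU → y∉xU ∘ there) w∉xU

  filter-fresh-∷ : ∀ U x ws → filter (fresh? U) (map (x ∷_) ws)
    ≡ (if does (x ∉? U) then map (x ∷_) (filter (fresh? (x ∷ U)) ws) else [])
  filter-fresh-∷ U x ws with x ∈? U
  ... | yes x∈U = List.filter-none (fresh? U) (All.map⁺ (All.universal (λ w fresh → All.head (proj₂ fresh) x∈U) ws))
  ... | no  x∉U = go ws
    where
    go : ∀ ws → filter (fresh? U) (map (x ∷_) ws) ≡ map (x ∷_) (filter (fresh? (x ∷ U)) ws)
    go []       = ≡.refl
    go (w ∷ ws) with fresh? (x ∷ U) w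
    ... | yes f = begin
      filter (fresh? U) ((x ∷ w) ∷ map (x ∷_) ws)      ≡⟨ List.filter-accept (fresh? U) (fresh-∷⁺ x∉U f) ⟩
      (x ∷ w) ∷ filter (fresh? U) (map (x ∷_) ws)      ≡⟨ ≡.cong ((x ∷ w) ∷_) (go ws) ⟩
      map (x ∷_) (w ∷ filter (fresh? (x ∷ U)) ws)      ≡⟨ ≡.cong (map (x ∷_)) (List.filter-accept (fresh? (x ∷ U)) f) ⟨
      map (x ∷_) (filter (fresh? (x ∷ U)) (w ∷ ws))    ∎
      where open ≡.≡-Reasoning
    ... | no ¬f = begin
      filter (fresh? U) ((x ∷ w) ∷ map (x ∷_) ws)      ≡⟨ List.filter-reject (fresh? U) (¬f ∘ fresh-∷⁻) ⟩
      filter (fresh? U) (map (x ∷_) ws)                ≡⟨ go ws ⟩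
      map (x ∷_) (filter (fresh? (x ∷ U)) ws)          ≡⟨ ≡.cong (map (x ∷_)) (List.filter-reject (fresh? (x ∷ U)) ¬f) ⟨
      map (x ∷_) (filter (fresh? (x ∷ U)) (w ∷ ws))    ∎
      where open ≡.≡-Reasoning

  filter-∉-∷ : ∀ x U xs → filter (_≢? x) (filter (_∉? U) xs) ≡ filter (_∉? (x ∷ U)) xs
  filter-∉-∷ x U xs = ≡.trans (filter-filter (_≢? x) (_∉? U) xs)
    (List.filter-≐ _ (_∉? (x ∷ U))
      ((λ (y∉U , y≢x) → λ { (here y≡x) → y≢x y≡x ; (there y∈U) → y∉U y∈U }) ,
       (λ y∉xU → y∉xU ∘ there , y∉xU ∘ here))
      xs)

  select-unique : ∀ {xs} → Unique.Unique _≟_ xs → select xs ≡ map (λ x → x , filter (_≢? x) xs) xs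
  select-unique {[]}     []           = ≡.refl
  select-unique {y ∷ ys} (y∉ys ∷ uys) = ≡.cong₂ _∷_
    (≡.cong (y ,_) (≡.sym (≡.trans (List.filter-reject (_≢? y) (λ y≢y → y≢y ≡.refl))
                             (List.filter-all (_≢? y) (All.map (λ y≢z z≡y → y≢z (≡.sym z≡y)) y∉ys)))))
    (≡.trans (≡.cong (map _) (select-unique uys))
      (≡.trans (≡.sym (List.map-∘ ys))
        (List.map-cong-local (All.map (λ y≢x → ≡.cong (_ ,_) (≡.sym (List.filter-accept (_≢? _) y≢x))) y∉ys))))

  fresh-words : ∀ k U → filter (fresh? U) (words k n) ≡ arrangements k (filter (_∉? U) (allFin n))
  fresh-words zero    U = ≡.refl
  fresh-words (suc k) U = begin
    filter (fresh? U) (concatMap (λ x → map (x ∷_) (words k n)) (allFin n))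
      ≡⟨ filter-concatMap (fresh? U) _ (allFin n) ⟩
    concatMap (λ x → filter (fresh? U) (map (x ∷_) (words k n))) (allFin n)
      ≡⟨ List.concatMap-cong (λ x → filter-fresh-∷ U x (words k n)) (allFin n) ⟩
    concatMap (λ x → if does (x ∉? U) then map (x ∷_) (filter (fresh? (x ∷ U)) (words k n)) else []) (allFin n)
      ≡⟨ concatMap-filter (_∉? U) _ (allFin n) ⟩
    concatMap (λ x → map (x ∷_) (filter (fresh? (x ∷ U)) (words k n))) vs
      ≡⟨ List.concatMap-cong (λ x → ≡.cong (map (x ∷_))
           (≡.trans (fresh-words k (x ∷ U)) (≡.cong (arrangements k) (≡.sym (filter-∉-∷ x U (allFin n)))))) vs ⟩
    concatMap (λ x → map (x ∷_) (arrangements k (filter (_≢? x) vs))) vs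
      ≡⟨ List.concatMap-map _ _ vs ⟨
    concatMap (λ (y , ys) → map (y ∷_) (arrangements k ys)) (map (λ x → x , filter (_≢? x) vs) vs)
      ≡⟨ ≡.cong (concatMap _) (select-unique (Unique.filter⁺ (_∉? U) (Unique.allFin⁺ n))) ⟨
    arrangements (suc k) vs ∎
    where
    open ≡.≡-Reasoning
    vs = filter (_∉? U) (allFin n)

perms-arrangements : ∀ n → perms n ≡ arrangements n (allFin n)
perms-arrangements n = begin
  filter (Unique.unique? _≟_) (words n n)
    ≡⟨ List.filter-≐ (Unique.unique? _≟_) (fresh? []) ((λ u → u , nothing∈[] _) , proj₁) (words n n) ⟩
  filter (fresh? []) (words n n)                      ≡⟨ fresh-words n [] ⟩
  arrangements n (filter (_∉? []) (allFin n))         ≡⟨ ≡.cong (arrangements n) (List.filter-all (_∉? []) (nothing∈[] _)) ⟩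
  arrangements n (allFin n) ∎
  where
  open ≡.≡-Reasoning
  nothing∈[] : ∀ (xs : List (Fin n)) → All (_∉ []) xs
  nothing∈[] xs = All.universal (λ _ ()) xs

-- Sums over lists

module ListSum {c ℓ} (M : CommutativeMonoid c ℓ) where
  open CommutativeMonoid M
    renaming ( _∙_ to _+_; ε to 0#; ∙-cong to +-cong; ∙-congˡ to +-congˡ; ∙-congʳ to +-congʳ
             ; identityˡ to +-identityˡ; identityʳ to +-identityʳ; assoc to +-assoc)
  open import Algebra.Properties.CommutativeSemigroup commutativeSemigroup using (interchange; x∙yz≈y∙xz)
  open import Algebra.Definitions.RawMonoid rawMonoid using () renaming (_×_ to _·_)
  open import Algebra.Properties.Monoid.Mult monoid using () renaming (×-homo-0 to ·-homo-0; ×-homo-+ to ·-homo-+)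
  open import Relation.Binary.Reasoning.Setoid setoid

  ∑ : List A → (A → Carrier) → Carrier
  ∑ []       f = 0#
  ∑ (x ∷ xs) f = f x + ∑ xs f

  ∑-map : (g : A → B) (xs : List A) (f : B → Carrier) → ∑ (map g xs) f ≡ ∑ xs (f ∘ g)
  ∑-map g []       f = ≡.refl
  ∑-map g (x ∷ xs) f = ≡.cong (f (g x) +_) (∑-map g xs f)

  ∑-++ : (xs ys : List A) (f : A → Carrier) → ∑ (xs ++ ys) f ≈ ∑ xs f + ∑ ys f
  ∑-++ []       ys f = sym (+-identityˡ _)
  ∑-++ (x ∷ xs) ys f = trans (+-congˡ (∑-++ xs ys f)) (sym (+-assoc _ _ _))

  ∑-concatMap : (g : A → List B) (xs : List A) (f : B → Carrier) → ∑ (concatMap g xs) f ≈ ∑ xs (λ x → ∑ (g x) f)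
  ∑-concatMap g []       f = refl
  ∑-concatMap g (x ∷ xs) f = trans (∑-++ (g x) (concatMap g xs) f) (+-congˡ (∑-concatMap g xs f))

  ∑-congᴬ : {xs : List A} {f g : A → Carrier} → All (λ x → f x ≈ g x) xs → ∑ xs f ≈ ∑ xs g
  ∑-congᴬ []         = refl
  ∑-congᴬ (fx≈gx ∷ e) = +-cong fx≈gx (∑-congᴬ e)

  ∑-cong : (xs : List A) {f g : A → Carrier} → (∀ x → f x ≈ g x) → ∑ xs f ≈ ∑ xs g
  ∑-cong xs f≈g = ∑-congᴬ (All.universal f≈g xs)

  ∑-distrib : (xs : List A) (f g : A → Carrier) → ∑ xs (λ x → f x + g x) ≈ ∑ xs f + ∑ xs g
  ∑-distrib []       f g = sym (+-identityˡ _)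
  ∑-distrib (x ∷ xs) f g = trans (+-congˡ (∑-distrib xs f g)) (interchange _ _ _ _)

  ∑-zero : (xs : List A) → ∑ xs (λ _ → 0#) ≈ 0#
  ∑-zero []       = refl
  ∑-zero (x ∷ xs) = trans (+-identityˡ _) (∑-zero xs)

  ∑-select-∷ : (y : A) (ys : List A) (G : A × List A → Carrier) →
    ∑ (select (y ∷ ys)) G ≈ G (y , ys) + ∑ (select ys) (λ (x , r) → G (x , y ∷ r))
  ∑-select-∷ y ys G = +-congˡ (reflexive (∑-map _ (select ys) G))

  ∑-select-↭ : {xs ys : List A} → xs ↭ ys → (G : A × List A → Carrier) →
    (∀ x {r r′} → r ↭ r′ → G (x , r) ≈ G (x , r′)) → ∑ (select xs) G ≈ ∑ (select ys) G
  ∑-select-↭ ↭.refl G resp = refl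
  ∑-select-↭ {xs = x ∷ xs} {x ∷ ys} (prep x p) G resp = begin
    ∑ (select (x ∷ xs)) G                                  ≈⟨ ∑-select-∷ x xs G ⟩
    G (x , xs) + ∑ (select xs) (λ (y , r) → G (y , x ∷ r))
      ≈⟨ +-cong (resp x p) (∑-select-↭ p _ (λ y q → resp y (prep x q))) ⟩
    G (x , ys) + ∑ (select ys) (λ (y , r) → G (y , x ∷ r)) ≈⟨ ∑-select-∷ x ys G ⟨
    ∑ (select (x ∷ ys)) G                                  ∎
  ∑-select-↭ {xs = x ∷ y ∷ xs} {y ∷ x ∷ ys} (swap x y p) G resp = begin
    ∑ (select (x ∷ y ∷ xs)) G
      ≈⟨ trans (∑-select-∷ x (y ∷ xs) G) (+-congˡ (∑-select-∷ y xs _)) ⟩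
    G (x , y ∷ xs) + (G (y , x ∷ xs) + ∑ (select xs) (λ (z , r) → G (z , x ∷ y ∷ r)))
      ≈⟨ x∙yz≈y∙xz _ _ _ ⟩
    G (y , x ∷ xs) + (G (x , y ∷ xs) + ∑ (select xs) (λ (z , r) → G (z , x ∷ y ∷ r)))
      ≈⟨ +-cong (resp y (prep x p)) (+-cong (resp x (prep y p))
           (trans (∑-select-↭ p _ (λ z q → resp z (prep x (prep y q))))
                  (∑-cong (select ys) (λ (z , r) → resp z (swap x y ↭.refl))))) ⟩
    G (y , x ∷ ys) + (G (x , y ∷ ys) + ∑ (select ys) (λ (z , r) → G (z , y ∷ x ∷ r)))
      ≈⟨ trans (∑-select-∷ y (x ∷ ys) G) (+-congˡ (∑-select-∷ x ys _)) ⟨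
    ∑ (select (y ∷ x ∷ ys)) G ∎
  ∑-select-↭ (↭.trans p q) G resp = trans (∑-select-↭ p G resp) (∑-select-↭ q G resp)

  ∑-arrangements-suc : (k : ℕ) (xs : List A) (F : List A → Carrier) →
    ∑ (arrangements (suc k) xs) F ≈ ∑ (select xs) (λ (y , r) → ∑ (arrangements k r) (F ∘ (y ∷_)))
  ∑-arrangements-suc k xs F = trans (∑-concatMap _ (select xs) F)
    (∑-cong (select xs) (λ (y , r) → reflexive (∑-map (y ∷_) (arrangements k r) F)))

  ∑-arrangements-map : (f : A → B) (k : ℕ) (xs : List A) (F : List B → Carrier) →
    ∑ (arrangements k (map f xs)) F ≡ ∑ (arrangements k xs) (F ∘ map f)
  ∑-arrangements-map f k xs F = ≡.trans (≡.cong (λ ws → ∑ ws F) (arrangements-map f k xs)) (∑-map (map f) (arrangements k xs) F)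

  ∑-arrangements-↭ : (k : ℕ) {xs ys : List A} → xs ↭ ys → (F : List A → Carrier) →
    ∑ (arrangements k xs) F ≈ ∑ (arrangements k ys) F
  ∑-arrangements-↭ zero    p F = refl
  ∑-arrangements-↭ (suc k) {xs} {ys} p F = begin
    ∑ (arrangements (suc k) xs) F
      ≈⟨ ∑-arrangements-suc k xs F ⟩
    ∑ (select xs) (λ (y , r) → ∑ (arrangements k r) (F ∘ (y ∷_)))
      ≈⟨ ∑-select-↭ p _ (λ y q → ∑-arrangements-↭ k q (F ∘ (y ∷_))) ⟩
    ∑ (select ys) (λ (y , r) → ∑ (arrangements k r) (F ∘ (y ∷_)))
      ≈⟨ ∑-arrangements-suc k ys F ⟨
    ∑ (arrangements (suc k) ys) F ∎

  ifEmpty : List A → Carrier → Carrier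
  ifEmpty []      x = x
  ifEmpty (_ ∷ _) _ = 0#

  ∑-permutations-uncons : (S : List A) (G : List A → Carrier) →
    ∑ (permutations S) G ≈ ifEmpty S (G []) + ∑ (select S) (λ (y , r) → ∑ (permutations r) (G ∘ (y ∷_)))
  ∑-permutations-uncons []       G = refl
  ∑-permutations-uncons (x ∷ xs) G = begin
    ∑ (arrangements (suc (length xs)) (x ∷ xs)) G
      ≈⟨ ∑-arrangements-suc (length xs) (x ∷ xs) G ⟩
    ∑ (select (x ∷ xs)) (λ (y , r) → ∑ (arrangements (length xs) r) (G ∘ (y ∷_)))
      ≈⟨ ∑-congᴬ (All.map (λ {(y , r)} len → reflexive (≡.cong (λ k → ∑ (arrangements k r) (G ∘ (y ∷_)))
                                                                    (ℕ.suc-injective len)))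
                          (select-length (x ∷ xs))) ⟩
    ∑ (select (x ∷ xs)) (λ (y , r) → ∑ (permutations r) (G ∘ (y ∷_)))
      ≈⟨ +-identityˡ _ ⟨
    0# + ∑ (select (x ∷ xs)) (λ (y , r) → ∑ (permutations r) (G ∘ (y ∷_))) ∎

  ∑-splits-∷ : (y : A) (ys : List A) (H : List A × List A → Carrier) →
    ∑ (splits (y ∷ ys)) H ≈ ∑ (splits ys) (λ (S , T) → H (y ∷ S , T)) + ∑ (splits ys) (λ (S , T) → H (S , y ∷ T))
  ∑-splits-∷ y ys H = trans (∑-++ (map (Product.map₁ (y ∷_)) (splits ys)) _ H)
    (+-cong (reflexive (∑-map _ (splits ys) H)) (reflexive (∑-map _ (splits ys) H)))

  ∑-splits-ifEmpty : (xs : List A) (H : List A → Carrier) → ∑ (splits xs) (λ (S , T) → ifEmpty S (H T)) ≈ H xs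
  ∑-splits-ifEmpty []       H = +-identityʳ (H [])
  ∑-splits-ifEmpty (y ∷ ys) H = begin
    ∑ (splits (y ∷ ys)) (λ (S , T) → ifEmpty S (H T))
      ≈⟨ ∑-splits-∷ y ys _ ⟩
    ∑ (splits ys) (λ _ → 0#) + ∑ (splits ys) (λ (S , T) → ifEmpty S (H (y ∷ T)))
      ≈⟨ +-cong (∑-zero (splits ys)) (∑-splits-ifEmpty ys (H ∘ (y ∷_))) ⟩
    0# + H (y ∷ ys)
      ≈⟨ +-identityˡ _ ⟩
    H (y ∷ ys) ∎

  ∑-splits-select : (xs : List A) (K : A → List A → List A → Carrier) →
    ∑ (splits xs) (λ (S , T) → ∑ (select S) (λ (y , S′) → K y S′ T))
      ≈ ∑ (select xs) (λ (y , r) → ∑ (splits r) (λ (S′ , T) → K y S′ T))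
  ∑-splits-select []       K = +-identityʳ _
  ∑-splits-select (x ∷ xs) K = begin
    ∑ (splits (x ∷ xs)) (λ (S , T) → ∑ (select S) (λ (y , S′) → K y S′ T))
      ≈⟨ ∑-splits-∷ x xs _ ⟩
    ∑ (splits xs) (λ (S , T) → ∑ (select (x ∷ S)) (λ (y , S′) → K y S′ T))
      + ∑ (splits xs) (λ (S , T) → ∑ (select S) (λ (y , S′) → K y S′ (x ∷ T)))
      ≈⟨ +-cong (trans (∑-cong (splits xs) (λ (S , T) → ∑-select-∷ x S _)) (∑-distrib (splits xs) _ _))
                (∑-splits-select xs (λ y S′ T → K y S′ (x ∷ T))) ⟩
    (∑ (splits xs) (λ (S , T) → K x S T) + ∑ (splits xs) (λ (S , T) → ∑ (select S) (λ (y , S′) → K y (x ∷ S′) T)))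
      + ∑ (select xs) (λ (y , r) → ∑ (splits r) (λ (S′ , T) → K y S′ (x ∷ T)))
      ≈⟨ +-congʳ (+-congˡ (∑-splits-select xs (λ y S′ T → K y (x ∷ S′) T))) ⟩
    (∑ (splits xs) (λ (S , T) → K x S T) + ∑ (select xs) (λ (y , r) → ∑ (splits r) (λ (S′ , T) → K y (x ∷ S′) T)))
      + ∑ (select xs) (λ (y , r) → ∑ (splits r) (λ (S′ , T) → K y S′ (x ∷ T)))
      ≈⟨ +-assoc _ _ _ ⟩
    ∑ (splits xs) (λ (S , T) → K x S T)
      + (∑ (select xs) (λ (y , r) → ∑ (splits r) (λ (S′ , T) → K y (x ∷ S′) T))
         + ∑ (select xs) (λ (y , r) → ∑ (splits r) (λ (S′ , T) → K y S′ (x ∷ T))))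
      ≈⟨ +-congˡ (trans (∑-cong (select xs) (λ (y , r) → ∑-splits-∷ x r _)) (∑-distrib (select xs) _ _)) ⟨
    ∑ (splits xs) (λ (S , T) → K x S T) + ∑ (select xs) (λ (y , r) → ∑ (splits (x ∷ r)) (λ (S′ , T) → K y S′ T))
      ≈⟨ ∑-select-∷ x xs _ ⟨
    ∑ (select (x ∷ xs)) (λ (y , r) → ∑ (splits r) (λ (S′ , T) → K y S′ T)) ∎

  ∑-permutations-∷-splits : (m : A) (xs : List A) (F : List A → Carrier) →
    ∑ (permutations (m ∷ xs)) F
      ≈ ∑ (splits xs) (λ (S , T) → ∑ (permutations S) (λ σ → ∑ (permutations T) (λ τ → F (σ ++ m ∷ τ))))
  ∑-permutations-∷-splits {A = A} m xs = go (length xs) xs ≡.refl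
    where
    around : List A → (List A → Carrier) → Carrier
    around xs F = ∑ (splits xs) (λ (S , T) → ∑ (permutations S) (λ σ → ∑ (permutations T) (λ τ → F (σ ++ m ∷ τ))))

    go : ∀ k xs → length xs ≡ k → ∀ F → ∑ (arrangements (suc k) (m ∷ xs)) F ≈ around xs F
    below : ∀ k y r → k ≡ suc (length r) → ∀ F → ∑ (arrangements k (m ∷ r)) (F ∘ (y ∷_)) ≈ around r (F ∘ (y ∷_))

    below (suc k) y r k≡ F = go k r (≡.sym (ℕ.suc-injective k≡)) (F ∘ (y ∷_))

    go k xs len F = begin
      ∑ (arrangements (suc k) (m ∷ xs)) F
        ≈⟨ trans (∑-arrangements-suc k (m ∷ xs) F) (∑-select-∷ m xs _) ⟩
      ∑ (arrangements k xs) (F ∘ (m ∷_)) + ∑ (select xs) (λ (y , r) → ∑ (arrangements k (m ∷ r)) (F ∘ (y ∷_)))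
        ≈⟨ +-cong (reflexive (≡.cong (λ k → ∑ (arrangements k xs) (F ∘ (m ∷_))) (≡.sym len)))
                  (∑-congᴬ (All.map (λ {(y , r)} len′ → below k y r (≡.trans (≡.sym len) len′) F) (select-length xs))) ⟩
      ∑ (permutations xs) (F ∘ (m ∷_)) + ∑ (select xs) (λ (y , r) → around r (F ∘ (y ∷_)))
        ≈⟨ +-cong (∑-splits-ifEmpty xs (λ T → ∑ (permutations T) (F ∘ (m ∷_))))
                  (∑-splits-select xs (λ y S T → ∑ (permutations S) (λ σ →
                                                  ∑ (permutations T) (λ τ → F (y ∷ σ ++ m ∷ τ))))) ⟨
      ∑ (splits xs) (λ (S , T) → ifEmpty S (∑ (permutations T) (F ∘ (m ∷_))))
        + ∑ (splits xs) (λ (S , T) → ∑ (select S) (λ (y , S′) →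
                                       ∑ (permutations S′) (λ σ → ∑ (permutations T) (λ τ → F (y ∷ σ ++ m ∷ τ)))))
        ≈⟨ ∑-distrib (splits xs) _ _ ⟨
      ∑ (splits xs) (λ (S , T) → ifEmpty S (∑ (permutations T) (F ∘ (m ∷_)))
        + ∑ (select S) (λ (y , S′) → ∑ (permutations S′) (λ σ → ∑ (permutations T) (λ τ → F (y ∷ σ ++ m ∷ τ)))))
        ≈⟨ ∑-cong (splits xs) (λ (S , T) →
             ∑-permutations-uncons S (λ σ → ∑ (permutations T) (λ τ → F (σ ++ m ∷ τ)))) ⟨
      around xs F ∎

  ∑< : ℕ → (ℕ → Carrier) → Carrier
  ∑< zero    f = 0#
  ∑< (suc n) f = f 0 + ∑< n (f ∘ suc)

  ∑<-cong : ∀ n {f g : ℕ → Carrier} → (∀ i → i ℕ.< n → f i ≈ g i) → ∑< n f ≈ ∑< n g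
  ∑<-cong zero    f≈g = refl
  ∑<-cong (suc n) f≈g = +-cong (f≈g 0 (ℕ.s≤s ℕ.z≤n)) (∑<-cong n (λ i i<n → f≈g (suc i) (ℕ.s≤s i<n)))

  ∑<-distrib : ∀ n (f g : ℕ → Carrier) → ∑< n (λ i → f i + g i) ≈ ∑< n f + ∑< n g
  ∑<-distrib zero    f g = sym (+-identityˡ _)
  ∑<-distrib (suc n) f g = trans (+-congˡ (∑<-distrib n _ _)) (interchange _ _ _ _)

  ∑<-suc : ∀ n (f : ℕ → Carrier) → ∑< (suc n) f ≈ ∑< n f + f n
  ∑<-suc zero    f = trans (+-identityʳ _) (sym (+-identityˡ _))
  ∑<-suc (suc n) f = trans (+-congˡ (∑<-suc n (f ∘ suc))) (sym (+-assoc _ _ _))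

  ∑-applyUpTo : (h : ℕ → A) (n : ℕ) (f : A → Carrier) → ∑ (applyUpTo h n) f ≡ ∑< n (f ∘ h)
  ∑-applyUpTo h zero    f = ≡.refl
  ∑-applyUpTo h (suc n) f = ≡.cong (f (h 0) +_) (∑-applyUpTo (h ∘ suc) n f)

  ∑-splits-length : (xs : List A) (f : ℕ → Carrier) →
    ∑ (splits xs) (λ (S , _) → f (length S)) ≈ ∑< (suc (length xs)) (λ i → (length xs C i) · f i)
  ∑-splits-length []       f = +-congʳ (sym (+-identityʳ _))
  ∑-splits-length (y ∷ ys) f = begin
    ∑ (splits (y ∷ ys)) (λ (S , _) → f (length S))
      ≈⟨ trans (∑-splits-∷ y ys _) (+-cong (∑-splits-length ys (f ∘ suc)) (∑-splits-length ys f)) ⟩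
    ∑< (suc n) (λ i → (n C i) · f (suc i)) + ((n C 0) · f 0 + ∑< n (λ i → (n C suc i) · f (suc i)))
      ≈⟨ x∙yz≈y∙xz _ _ _ ⟩
    (n C 0) · f 0 + (∑< (suc n) (λ i → (n C i) · f (suc i)) + ∑< n (λ i → (n C suc i) · f (suc i)))
      ≈⟨ +-congˡ (+-congˡ (trans (sym (+-identityʳ _)) (+-congˡ (sym (nC[n+1]-vanishes))))) ⟩
    (n C 0) · f 0 + (∑< (suc n) (λ i → (n C i) · f (suc i)) + (∑< n (λ i → (n C suc i) · f (suc i)) + (n C suc n) · f (suc n)))
      ≈⟨ +-congˡ (+-congˡ (∑<-suc n (λ i → (n C suc i) · f (suc i)))) ⟨
    (n C 0) · f 0 + (∑< (suc n) (λ i → (n C i) · f (suc i)) + ∑< (suc n) (λ i → (n C suc i) · f (suc i)))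
      ≈⟨ +-congˡ (∑<-distrib (suc n) (λ i → (n C i) · f (suc i)) (λ i → (n C suc i) · f (suc i))) ⟨
    (n C 0) · f 0 + ∑< (suc n) (λ i → (n C i) · f (suc i) + (n C suc i) · f (suc i))
      ≈⟨ +-congˡ (∑<-cong (suc n) (λ i _ → trans (sym (·-homo-+ (f (suc i)) (n C i) (n C suc i)))
                                                (reflexive (≡.cong (_· f (suc i)) (nCk+nC[k+1]≡[n+1]C[k+1] n i))))) ⟩
    (suc n C 0) · f 0 + ∑< (suc n) (λ i → (suc n C suc i) · f (suc i)) ∎
    where
    n = length ys
    nC[n+1]-vanishes : (n C suc n) · f (suc n) ≈ 0#
    nC[n+1]-vanishes = trans (reflexive (≡.cong (_· f (suc n)) (k>n⇒nCk≡0 (ℕ.n<1+n n)))) (·-homo-0 (f (suc n)))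

-- Order-preserving and order-reversing relabellings

<ᵇ-≡ : ∀ {m n u v} → (m < n → u < v) → (u < v → m < n) → (m <ᵇ n) ≡ (u <ᵇ v)
<ᵇ-≡ {m} {n} {u} {v} to from with m <ᵇ n | ℕ.<ᵇ-reflects-< m n | u <ᵇ v | ℕ.<ᵇ-reflects-< u v
... | true  | _       | true  | _       = ≡.refl
... | false | _       | false | _       = ≡.refl
... | true  | ofʸ m<n | false | ofⁿ u≮v = ⊥-elim (u≮v (to m<n))
... | false | ofⁿ m≮n | true  | ofʸ u<v = ⊥-elim (m≮n (from u<v))

<ᵇ-monotone : ∀ {k} (f : Fin k → ℕ) → (∀ {x y} → x Fin.< y → f x < f y) →
  ∀ x y → (f x <ᵇ f y) ≡ (toℕ x <ᵇ toℕ y)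
<ᵇ-monotone f mono x y = <ᵇ-≡ reflect mono
  where
  reflect : f x < f y → x Fin.< y
  reflect fx<fy with Fin.<-cmp x y
  ... | tri< x<y _ _ = x<y
  ... | tri≈ _ ≡.refl _ = ⊥-elim (ℕ.<-irrefl ≡.refl fx<fy)
  ... | tri> _ _ y<x = ⊥-elim (ℕ.<-asym fx<fy (mono y<x))

<ᵇ-opposite : ∀ {k} (x y : Fin k) → (toℕ (opposite x) <ᵇ toℕ (opposite y)) ≡ (toℕ y <ᵇ toℕ x)
<ᵇ-opposite {k} x y = <ᵇ-≡
  (λ lt → ℕ.s<s⁻¹ (ℕ.∸-cancelʳ-< {o = k} (≡.subst₂ _<_ (Fin.opposite-prop x) (Fin.opposite-prop y) lt)))
  (λ y<x → ≡.subst₂ _<_ (≡.sym (Fin.opposite-prop x)) (≡.sym (Fin.opposite-prop y))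
                        (ℕ.∸-monoʳ-< (ℕ.s≤s y<x) (Fin.toℕ<n x)))

<⇒<ᵇ≡true : ∀ {x y} → x < y → (x <ᵇ y) ≡ true
<⇒<ᵇ≡true (ℕ.s≤s ℕ.z≤n)       = ≡.refl
<⇒<ᵇ≡true (ℕ.s≤s (ℕ.s≤s x<y)) = <⇒<ᵇ≡true (ℕ.s≤s x<y)

<⇒>ᵇ≡false : ∀ {x y} → x < y → (y <ᵇ x) ≡ false
<⇒>ᵇ≡false {zero}  (ℕ.s≤s _)   = ≡.refl
<⇒>ᵇ≡false {suc x} (ℕ.s≤s x<y) = <⇒>ᵇ≡false x<y

isEven-suc : ∀ n → isEven (suc n) ≡ not (isEven n)
isEven-suc zero          = ≡.refl
isEven-suc (suc zero)    = ≡.refl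
isEven-suc (suc (suc n)) = isEven-suc n

applyUpTo-tabulate : (f : ℕ → A) (k : ℕ) → applyUpTo f k ≡ tabulate {n = k} (f ∘ toℕ)
applyUpTo-tabulate f zero    = ≡.refl
applyUpTo-tabulate f (suc k) = ≡.cong (f 0 ∷_) (applyUpTo-tabulate (f ∘ suc) k)

downFrom-tabulate : ∀ k → downFrom k ≡ tabulate (λ (i : Fin k) → k ∸ suc (toℕ i))
downFrom-tabulate zero    = ≡.refl
downFrom-tabulate (suc k) = ≡.cong (k ∷_) (downFrom-tabulate k)

map-lookup-allFin : (xs : List A) → map (lookup xs) (allFin (length xs)) ≡ xs
map-lookup-allFin xs = ≡.trans (List.map-tabulate id (lookup xs)) (List.tabulate-lookup xs)

map-toℕ-allFin : ∀ k → map toℕ (allFin k) ≡ upTo k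
map-toℕ-allFin k = ≡.trans (List.map-tabulate id toℕ) (≡.sym (applyUpTo-tabulate id k))

map-opposite-allFin : ∀ k → map (toℕ ∘ opposite) (allFin k) ≡ downFrom k
map-opposite-allFin k = ≡.trans (List.map-tabulate {n = k} id (toℕ ∘ opposite))
  (≡.trans (List.tabulate-cong Fin.opposite-prop) (≡.sym (downFrom-tabulate k)))

lookup-monotone : ∀ {xs : List ℕ} → AllPairs _<_ xs → ∀ {x y} → x Fin.< y → lookup xs x < lookup xs y
lookup-monotone (x<xs ∷ _)   {Fin.zero}  {Fin.suc y} _ = All.lookup x<xs (∈-lookup _)
lookup-monotone (_ ∷ sorted) {Fin.suc x} {Fin.suc y} (ℕ.s≤s x<y) = lookup-monotone sorted x<y

-- Alternating-descent weights

module AlternatingDescents {c ℓ} (R : CommutativeSemiring c ℓ) where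
  open CommutativeSemiring R
  open import Algebra.Definitions.RawSemiring rawSemiring using (_^_) renaming (_×_ to _·_)
  open import Algebra.Properties.Monoid.Mult +-monoid using () renaming (×-congʳ to ·-congʳ; ×-homo-1 to ·-homo-1)
  open import Algebra.Properties.Semiring.Exp semiring using (^-homo-*)
  open import Algebra.Properties.Semiring.Mult semiring using (×-assoc-*; ×-comm-*)
  open import Algebra.Properties.CommutativeSemigroup *-commutativeSemigroup using () renaming (interchange to *-interchange)
  open ListSum +-commutativeMonoid
  open import Relation.Binary.Reasoning.Setoid setoid

  ∑-*ˡ : (xs : List A) (x : Carrier) (f : A → Carrier) → ∑ xs (λ y → x * f y) ≈ x * ∑ xs f
  ∑-*ˡ []       x f = sym (zeroʳ x)
  ∑-*ˡ (y ∷ xs) x f = trans (+-congˡ (∑-*ˡ xs x f)) (sym (distribˡ x _ _))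

  ∑-*ʳ : (xs : List A) (x : Carrier) (f : A → Carrier) → ∑ xs (λ y → f y * x) ≈ ∑ xs f * x
  ∑-*ʳ []       x f = sym (zeroˡ x)
  ∑-*ʳ (y ∷ xs) x f = trans (+-congˡ (∑-*ʳ xs x f)) (sym (distribʳ x _ _))

  ∑-*-∑ : (xs : List A) (ys : List B) (f : A → Carrier) (g : B → Carrier) →
    ∑ xs (λ x → ∑ ys (λ y → f x * g y)) ≈ ∑ xs f * ∑ ys g
  ∑-*-∑ xs ys f g = trans (∑-cong xs (λ x → ∑-*ˡ ys (f x) g)) (∑-*ʳ xs (∑ ys g) f)

  sumR-map : (xs : List A) (f : A → Carrier) → sumR R (map f xs) ≡ ∑ xs f
  sumR-map []       f = ≡.refl
  sumR-map (x ∷ xs) f = ≡.cong (f x +_) (sumR-map xs f)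

  module _ (q : Carrier) where

    -- weight o t i w is ∏ t qʲ over the alternating descents j of w when its first letter sits at
    -- position i and parities are shifted by o: o = 0 is the convention of altD, odd o interchanges
    -- ascents and descents.

    mark : Bool → Carrier → ℕ → Carrier
    mark b t i = if b then t * q ^ i else 1#

    isAltDescent : ℕ → ℕ → ℕ → ℕ → Bool
    isAltDescent o i x y = if isEven (o ℕ.+ i) then x <ᵇ y else y <ᵇ x

    weight : ℕ → Carrier → ℕ → List ℕ → Carrier
    weight o t i (x ∷ y ∷ w) = mark (isAltDescent o i x y) t i * weight o t (suc i) (y ∷ w)
    weight o t i _           = 1#

    mark-cong : ∀ b {t t′} i → t ≈ t′ → mark b t i ≈ mark b t′ i
    mark-cong true  i t≈t′ = *-congʳ t≈t′
    mark-cong false i t≈t′ = refl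

    weight-cong : ∀ o {t t′} i w → t ≈ t′ → weight o t i w ≈ weight o t′ i w
    weight-cong o i (x ∷ y ∷ w) t≈t′ = *-cong (mark-cong _ i t≈t′) (weight-cong o (suc i) (y ∷ w) t≈t′)
    weight-cong o i []          t≈t′ = refl
    weight-cong o i (x ∷ [])    t≈t′ = refl

    weight-shift : ∀ o t d j w → weight o t (d ℕ.+ j) w ≈ weight (o ℕ.+ d) (t * q ^ d) j w
    weight-shift o t d j (x ∷ y ∷ w) = *-cong
      (trans (mark-shift (isAltDescent o (d ℕ.+ j) x y))
             (reflexive (≡.cong (λ p → mark (if isEven p then x <ᵇ y else y <ᵇ x) (t * q ^ d) j)
                                (≡.sym (ℕ.+-assoc o d j)))))
      (trans (reflexive (≡.cong (λ i → weight o t i (y ∷ w)) (≡.sym (ℕ.+-suc d j))))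
             (weight-shift o t d (suc j) (y ∷ w)))
      where
      mark-shift : ∀ b → mark b t (d ℕ.+ j) ≈ mark b (t * q ^ d) j
      mark-shift true  = trans (*-congˡ (^-homo-* q d j)) (sym (*-assoc t _ _))
      mark-shift false = refl
    weight-shift o t d j []       = refl
    weight-shift o t d j (x ∷ []) = refl

    isAltDescent-suc : ∀ o i x y → isAltDescent (suc o) i x y ≡ isAltDescent o i y x
    isAltDescent-suc o i x y rewrite isEven-suc (o ℕ.+ i) with isEven (o ℕ.+ i)
    ... | true  = ≡.refl
    ... | false = ≡.refl

    weight-map : ∀ {A : Set} {o o′ t} (f g : A → ℕ) →
      (∀ i x y → isAltDescent o i (f x) (f y) ≡ isAltDescent o′ i (g x) (g y)) →
      ∀ i w → weight o t i (map f w) ≡ weight o′ t i (map g w)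
    weight-map {t = t} f g same i (x ∷ y ∷ w) =
      ≡.cong₂ _*_ (≡.cong (λ b → mark b t i) (same i x y)) (weight-map f g same (suc i) (y ∷ w))
    weight-map f g same i []       = ≡.refl
    weight-map f g same i (x ∷ []) = ≡.refl

    weight-map-monotone : ∀ {A : Set} {o t} (f g : A → ℕ) → (∀ x y → (f x <ᵇ f y) ≡ (g x <ᵇ g y)) →
      ∀ i w → weight o t i (map f w) ≡ weight o t i (map g w)
    weight-map-monotone {o = o} f g same = weight-map f g (λ i x y →
      ≡.cong₂ (if isEven (o ℕ.+ i) then_else_) (same x y) (same y x))

    weight-map-antitone : ∀ {A : Set} {o t} (f g : A → ℕ) → (∀ x y → (f x <ᵇ f y) ≡ (g y <ᵇ g x)) →
      ∀ i w → weight (suc o) t i (map f w) ≡ weight o t i (map g w)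
    weight-map-antitone {o = o} f g reversed = weight-map f g (λ i x y →
      ≡.trans (isAltDescent-suc o i (f x) (f y)) (≡.cong₂ (if isEven (o ℕ.+ i) then_else_) (reversed y x) (reversed x y)))

    isAltDescent-< : ∀ o i {x y} → x < y → isAltDescent o i x y ≡ isEven (o ℕ.+ i)
    isAltDescent-< o i x<y with isEven (o ℕ.+ i)
    ... | true  = <⇒<ᵇ≡true x<y
    ... | false = <⇒>ᵇ≡false x<y

    isAltDescent-> : ∀ o i {x y} → y < x → isAltDescent o i x y ≡ not (isEven (o ℕ.+ i))
    isAltDescent-> o i {x} {y} y<x = ≡.trans (≡.sym (isAltDescent-suc o i y x))
      (≡.trans (isAltDescent-< (suc o) i y<x) (isEven-suc (o ℕ.+ i)))

    -- For a minimum letter at position P with L letters before and l after it: the weights of the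
    -- step into it (at position P ∸ 1, which is only consulted when L > 0) and out of it.

    fall : ℕ → Carrier → ℕ → ℕ → Carrier
    fall o t P zero    = 1#
    fall o t P (suc _) = mark (not (isEven (o ℕ.+ (P ∸ 1)))) t (P ∸ 1)

    rise : ℕ → Carrier → ℕ → ℕ → Carrier
    rise o t P zero    = 1#
    rise o t P (suc _) = mark (isEven (o ℕ.+ P)) t P

    weight-∷-min : ∀ o t i {m τ} → All (m <_) τ → weight o t i (m ∷ τ) ≈ rise o t i (length τ) * weight o t (suc i) τ
    weight-∷-min o t i []        = sym (*-identityˡ 1#)
    weight-∷-min o t i (m<y ∷ _) = *-congʳ (reflexive (≡.cong (λ b → mark b t i) (isAltDescent-< o i m<y)))

    weight-++-min : ∀ o t i {m} σ τ → All (m <_) σ → All (m <_) τ → ∀ P → P ≡ length σ ℕ.+ i →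
      weight o t i (σ ++ m ∷ τ)
        ≈ (weight o t i σ * fall o t P (length σ)) * (rise o t P (length τ) * weight o t (suc P) τ)
    weight-++-min o t i [] τ _ m<τ P ≡.refl =
      trans (weight-∷-min o t i m<τ) (trans (sym (*-identityˡ _)) (*-congʳ (sym (*-identityˡ 1#))))
    weight-++-min o t i (a ∷ []) τ (m<a ∷ []) m<τ P ≡.refl = *-cong
      (trans (reflexive (≡.cong (λ b → mark b t i) (isAltDescent-> o i m<a))) (sym (*-identityˡ _)))
      (weight-∷-min o t (suc i) m<τ)
    weight-++-min o t i (a ∷ b ∷ σ) τ (_ ∷ m<bσ) m<τ P P≡ = begin
      mark₀ * weight o t (suc i) (b ∷ σ ++ _ ∷ τ)
        ≈⟨ *-congˡ (weight-++-min o t (suc i) (b ∷ σ) τ m<bσ m<τ P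
                     (≡.trans P≡ (≡.cong suc (≡.sym (ℕ.+-suc (length σ) i))))) ⟩
      mark₀ * ((W * F) * Z)  ≈⟨ *-assoc mark₀ (W * F) Z ⟨
      (mark₀ * (W * F)) * Z  ≈⟨ *-congʳ (*-assoc mark₀ W F) ⟨
      ((mark₀ * W) * F) * Z  ∎
      where
      mark₀ = mark (isAltDescent o i a b) t i
      W = weight o t (suc i) (b ∷ σ)
      F = fall o t P (suc (length σ))
      Z = rise o t P (length τ) * weight o t (suc P) τ

    Â : ℕ → ℕ → Carrier → Carrier
    Â o n t = ∑ (arrangements n (upTo n)) (weight o t 1)

    Â-allFin : ∀ o n t → Â o n t ≡ ∑ (arrangements n (allFin n)) (weight o t 1 ∘ map toℕ)
    Â-allFin o n t = ≡.trans (≡.cong (λ xs → ∑ (arrangements n xs) (weight o t 1)) (≡.sym (map-toℕ-allFin n)))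
                             (∑-arrangements-map toℕ n (allFin n) (weight o t 1))

    Â-cong : ∀ o n {t t′} → t ≈ t′ → Â o n t ≈ Â o n t′
    Â-cong o n t≈t′ = ∑-cong (arrangements n (upTo n)) (λ w → weight-cong o 1 w t≈t′)

    Â-zero : ∀ o t → Â o 0 t ≈ 1#
    Â-zero o t = +-identityʳ 1#

    ∑-permutations-sorted : ∀ o t {S} → AllPairs _<_ S → ∑ (permutations S) (weight o t 1) ≈ Â o (length S) t
    ∑-permutations-sorted o t {S} sorted = begin
      ∑ (arrangements k S) (weight o t 1)
        ≡⟨ ≡.cong (λ xs → ∑ (arrangements k xs) (weight o t 1)) (map-lookup-allFin S) ⟨
      ∑ (arrangements k (map (lookup S) (allFin k))) (weight o t 1)
        ≡⟨ ∑-arrangements-map (lookup S) k (allFin k) (weight o t 1) ⟩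
      ∑ (arrangements k (allFin k)) (weight o t 1 ∘ map (lookup S))
        ≈⟨ ∑-cong (arrangements k (allFin k)) (λ w → reflexive
             (weight-map-monotone (lookup S) toℕ (<ᵇ-monotone (lookup S) (lookup-monotone sorted)) 1 w)) ⟩
      ∑ (arrangements k (allFin k)) (weight o t 1 ∘ map toℕ)
        ≡⟨ Â-allFin o k t ⟨
      Â o k t ∎
      where
      k = length S

    Â-complement : ∀ o n t → Â (suc o) n t ≈ Â o n t
    Â-complement o n t = begin
      Â (suc o) n t
        ≡⟨ Â-allFin (suc o) n t ⟩
      ∑ (arrangements n (allFin n)) (weight (suc o) t 1 ∘ map toℕ)
        ≈⟨ ∑-cong (arrangements n (allFin n)) (λ w → reflexive
             (weight-map-antitone toℕ (toℕ ∘ opposite) (λ x y → ≡.sym (<ᵇ-opposite y x)) 1 w)) ⟩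
      ∑ (arrangements n (allFin n)) (weight o t 1 ∘ map (toℕ ∘ opposite))
        ≡⟨ ∑-arrangements-map (toℕ ∘ opposite) n (allFin n) (weight o t 1) ⟨
      ∑ (arrangements n (map (toℕ ∘ opposite) (allFin n))) (weight o t 1)
        ≡⟨ ≡.cong (λ xs → ∑ (arrangements n xs) (weight o t 1)) (map-opposite-allFin n) ⟩
      ∑ (arrangements n (downFrom n)) (weight o t 1)
        ≈⟨ ∑-arrangements-↭ n (≡.subst (_↭ upTo n) (List.reverse-upTo n) (↭.↭-reverse (upTo n))) (weight o t 1) ⟩
      Â o n t ∎

    Â-offset : ∀ o n t → Â o n t ≈ Â 0 n t
    Â-offset zero    n t = refl
    Â-offset (suc o) n t = trans (Â-complement o n t) (Â-offset o n t)

    -- The contribution to Â o (L + l + 1) t of the permutations with L letters before their minimum.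
    aroundMinimum : ℕ → Carrier → ℕ → ℕ → Carrier
    aroundMinimum o t L l = (Â o L t * fall o t (L ℕ.+ 1) L) * (rise o t (L ℕ.+ 1) l * Â (o ℕ.+ suc L) l (t * q ^ suc L))

    ∑-permutations-around-min : ∀ o t {m S T} → AllPairs _<_ S → AllPairs _<_ T → All (m <_) S → All (m <_) T →
      ∑ (permutations S) (λ σ → ∑ (permutations T) (λ τ → weight o t 1 (σ ++ m ∷ τ)))
        ≈ aroundMinimum o t (length S) (length T)
    ∑-permutations-around-min o t {m} {S} {T} sortedS sortedT m<S m<T = begin
      ∑ (permutations S) (λ σ → ∑ (permutations T) (λ τ → weight o t 1 (σ ++ m ∷ τ)))
        ≈⟨ ∑-congᴬ (All.map (λ (m<σ , |σ|≡) → ∑-congᴬ (All.map (λ (m<τ , |τ|≡) →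
             factor m<σ |σ|≡ m<τ |τ|≡) (arrangements-All (length T) m<T))) (arrangements-All (length S) m<S)) ⟩
      ∑ (permutations S) (λ σ → ∑ (permutations T) (λ τ → (weight o t 1 σ * F) * (G * weight o′ t′ 1 τ)))
        ≈⟨ ∑-*-∑ (permutations S) (permutations T) _ _ ⟩
      ∑ (permutations S) (λ σ → weight o t 1 σ * F) * ∑ (permutations T) (λ τ → G * weight o′ t′ 1 τ)
        ≈⟨ *-cong (∑-*ʳ (permutations S) F _) (∑-*ˡ (permutations T) G _) ⟩
      (∑ (permutations S) (weight o t 1) * F) * (G * ∑ (permutations T) (weight o′ t′ 1))
        ≈⟨ *-cong (*-congʳ (∑-permutations-sorted o t sortedS)) (*-congˡ (∑-permutations-sorted o′ t′ sortedT)) ⟩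
      (Â o L t * F) * (G * Â o′ (length T) t′) ∎
      where
      L = length S
      o′ = o ℕ.+ suc L
      t′ = t * q ^ suc L
      F = fall o t (L ℕ.+ 1) L
      G = rise o t (L ℕ.+ 1) (length T)
      factor : ∀ {σ τ} → All (m <_) σ → length σ ≡ L → All (m <_) τ → length τ ≡ length T →
        weight o t 1 (σ ++ m ∷ τ) ≈ (weight o t 1 σ * F) * (G * weight o′ t′ 1 τ)
      factor {σ} {τ} m<σ |σ|≡L m<τ |τ|≡ = begin
        weight o t 1 (σ ++ m ∷ τ)
          ≈⟨ weight-++-min o t 1 σ τ m<σ m<τ (L ℕ.+ 1) (≡.cong (ℕ._+ 1) (≡.sym |σ|≡L)) ⟩
        (weight o t 1 σ * fall o t (L ℕ.+ 1) (length σ)) * (rise o t (L ℕ.+ 1) (length τ) * weight o t (suc L ℕ.+ 1) τ)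
          ≡⟨ ≡.cong₂ (λ k l → (weight o t 1 σ * fall o t (L ℕ.+ 1) k) * (rise o t (L ℕ.+ 1) l * weight o t (suc L ℕ.+ 1) τ))
                     |σ|≡L |τ|≡ ⟩
        (weight o t 1 σ * F) * (G * weight o t (suc L ℕ.+ 1) τ)
          ≈⟨ *-congˡ (*-congˡ (weight-shift o t (suc L) 1 τ)) ⟩
        (weight o t 1 σ * F) * (G * weight o′ t′ 1 τ) ∎

    Â-suc : ∀ o n t → Â o (suc n) t ≈ ∑ (splits (applyUpTo suc n)) (λ (S , T) → aroundMinimum o t (length S) (length T))
    Â-suc o n t = begin
      ∑ (arrangements (suc n) (0 ∷ xs)) (weight o t 1)
        ≡⟨ ≡.cong (λ k → ∑ (arrangements (suc k) (0 ∷ xs)) (weight o t 1)) (List.length-applyUpTo suc n) ⟨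
      ∑ (permutations (0 ∷ xs)) (weight o t 1)
        ≈⟨ ∑-permutations-∷-splits 0 xs (weight o t 1) ⟩
      ∑ (splits xs) (λ (S , T) → ∑ (permutations S) (λ σ → ∑ (permutations T) (λ τ → weight o t 1 (σ ++ 0 ∷ τ))))
        ≈⟨ ∑-congᴬ (All.map (λ (S⊆xs , T⊆xs , _) → ∑-permutations-around-min o t
             (AllPairs-resp-⊆ S⊆xs sorted) (AllPairs-resp-⊆ T⊆xs sorted)
             (All-resp-⊆ S⊆xs positive) (All-resp-⊆ T⊆xs positive))
             (splits-⊆ xs)) ⟩
      ∑ (splits xs) (λ (S , T) → aroundMinimum o t (length S) (length T)) ∎
      where
      xs = applyUpTo suc n
      sorted : AllPairs _<_ xs
      sorted = AllPairs.applyUpTo⁺₁ suc n (λ i<j _ → ℕ.s≤s i<j)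
      positive : All (0 <_) xs
      positive = All.applyUpTo⁺₂ suc n (λ _ → ℕ.z<s)

    -- The recurrence

    neighbours : Carrier → ℕ → ℕ → Carrier
    neighbours t L l = fall 0 t (L ℕ.+ 1) L * rise 0 t (L ℕ.+ 1) l + fall 1 t (L ℕ.+ 1) L * rise 1 t (L ℕ.+ 1) l

    aroundMinimum-both : ∀ t L l →
      aroundMinimum 0 t L l + aroundMinimum 1 t L l ≈ (neighbours t L l * Â 0 L t) * Â 0 l (t * q ^ suc L)
    aroundMinimum-both t L l = begin
      (Aσ * F 0) * (G 0 * Â (suc L) l t′) + (Â 1 L t * F 1) * (G 1 * Â (suc (suc L)) l t′)
        ≈⟨ +-cong (*-congˡ (*-congˡ (Â-offset (suc L) l t′)))
                  (*-cong (*-congʳ (Â-offset 1 L t)) (*-congˡ (Â-offset (suc (suc L)) l t′))) ⟩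
      (Aσ * F 0) * (G 0 * Aτ) + (Aσ * F 1) * (G 1 * Aτ)
        ≈⟨ +-cong (regroup (F 0) (G 0)) (regroup (F 1) (G 1)) ⟩
      ((F 0 * G 0) * Aσ) * Aτ + ((F 1 * G 1) * Aσ) * Aτ
        ≈⟨ trans (sym (distribʳ Aτ _ _)) (*-congʳ (sym (distribʳ Aσ _ _))) ⟩
      (neighbours t L l * Aσ) * Aτ ∎
      where
      t′ = t * q ^ suc L
      Aσ = Â 0 L t
      Aτ = Â 0 l t′
      F G : ℕ → Carrier
      F o = fall o t (L ℕ.+ 1) L
      G o = rise o t (L ℕ.+ 1) l
      regroup : ∀ f g → (Aσ * f) * (g * Aτ) ≈ ((f * g) * Aσ) * Aτ
      regroup f g = begin
        (Aσ * f) * (g * Aτ)  ≈⟨ *-assoc (Aσ * f) g Aτ ⟨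
        ((Aσ * f) * g) * Aτ  ≈⟨ *-congʳ (*-assoc Aσ f g) ⟩
        (Aσ * (f * g)) * Aτ  ≈⟨ *-congʳ (*-comm Aσ (f * g)) ⟩
        ((f * g) * Aσ) * Aτ  ∎

    minimumTerm : Carrier → ℕ → ℕ → Carrier
    minimumTerm t n i = (neighbours t i (n ∸ i) * Â 0 i t) * Â 0 (n ∸ i) (t * q ^ suc i)

    twice-Â-suc : ∀ n t → 2 · Â 0 (suc n) t ≈ ∑< (suc n) (λ i → (n C i) · minimumTerm t n i)
    twice-Â-suc n t = begin
      Â 0 (suc n) t + (Â 0 (suc n) t + 0#)
        ≈⟨ +-congˡ (trans (+-identityʳ _) (sym (Â-complement 0 (suc n) t))) ⟩
      Â 0 (suc n) t + Â 1 (suc n) t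
        ≈⟨ trans (+-cong (Â-suc 0 n t) (Â-suc 1 n t)) (sym (∑-distrib (splits xs) _ _)) ⟩
      ∑ (splits xs) (λ (S , T) → aroundMinimum 0 t (length S) (length T) + aroundMinimum 1 t (length S) (length T))
        ≈⟨ ∑-congᴬ (All.map (λ {(S , T)} (_ , _ , |S|+|T|≡) → trans (aroundMinimum-both t (length S) (length T))
             (reflexive (≡.cong (λ l → (neighbours t (length S) l * Â 0 (length S) t) * Â 0 l (t * q ^ suc (length S)))
                                (|T|≡ {length S} {length T} |S|+|T|≡))))
             (splits-⊆ xs)) ⟩
      ∑ (splits xs) (λ (S , _) → minimumTerm t n (length S))
        ≈⟨ ∑-splits-length xs (minimumTerm t n) ⟩
      ∑< (suc (length xs)) (λ i → (length xs C i) · minimumTerm t n i)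
        ≡⟨ ≡.cong (λ k → ∑< (suc k) (λ i → (k C i) · minimumTerm t n i)) (List.length-applyUpTo suc n) ⟩
      ∑< (suc n) (λ i → (n C i) · minimumTerm t n i) ∎
      where
      xs = applyUpTo suc n
      |T|≡ : ∀ {k l} → k ℕ.+ l ≡ length xs → l ≡ n ∸ k
      |T|≡ {k} {l} eq = ≡.trans (≡.sym (ℕ.m+n∸m≡n k l)) (≡.cong (_∸ k) (≡.trans eq (List.length-applyUpTo suc n)))

    mark-product : ∀ t p → (t * q ^ p) * (t * q ^ suc p) ≈ t ^ 2 * q ^ (2 ℕ.* p ℕ.+ 1)
    mark-product t p = begin
      (t * q ^ p) * (t * q ^ suc p)  ≈⟨ *-interchange t (q ^ p) t (q ^ suc p) ⟩
      (t * t) * (q ^ p * q ^ suc p)  ≈⟨ *-cong (*-congˡ (*-identityʳ t)) (^-homo-* q p (suc p)) ⟨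
      t ^ 2 * q ^ (p ℕ.+ suc p)      ≡⟨ ≡.cong (λ k → t ^ 2 * q ^ k) (double+1 p) ⟨
      t ^ 2 * q ^ (2 ℕ.* p ℕ.+ 1)    ∎
      where
      double+1 : ∀ p → 2 ℕ.* p ℕ.+ 1 ≡ p ℕ.+ suc p
      double+1 p = ≡.trans (ℕ.+-comm (2 ℕ.* p) 1)
        (≡.trans (≡.cong (λ k → suc (p ℕ.+ k)) (ℕ.+-identityʳ p)) (≡.sym (ℕ.+-suc p p)))

    neighbours-first : ∀ t l → neighbours t 0 (suc l) ≈ 1# + t * q
    neighbours-first t l = +-cong (*-identityˡ 1#) (trans (*-identityˡ _) (*-congˡ (*-identityʳ q)))

    neighbours-last : ∀ t k → neighbours t (suc k) 0 ≈ 1# + t * q ^ suc k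
    neighbours-last t k rewrite ℕ.+-comm k 1 | isEven-suc k =
      trans (+-cong (*-identityʳ _) (*-identityʳ _)) (mark-sum (isEven k))
      where
      mark-sum : ∀ b → mark (not (not b)) t (suc k) + mark (not b) t (suc k) ≈ 1# + t * q ^ suc k
      mark-sum true  = +-comm _ _
      mark-sum false = refl

    neighbours-middle : ∀ t k l → neighbours t (suc k) (suc l) ≈ 1# + t ^ 2 * q ^ (2 ℕ.* suc k ℕ.+ 1)
    neighbours-middle t k l rewrite ℕ.+-comm k 1 | isEven-suc k = mark-pairs (isEven k)
      where
      mark-pairs : ∀ b → mark (not (not b)) t (suc k) * mark b t (suc (suc k)) + mark (not b) t (suc k) * mark (not b) t (suc (suc k))
                           ≈ 1# + t ^ 2 * q ^ (2 ℕ.* suc k ℕ.+ 1)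
      mark-pairs true  = trans (+-comm _ _) (+-cong (*-identityˡ 1#) (mark-product t (suc k)))
      mark-pairs false = +-cong (*-identityˡ 1#) (mark-product t (suc k))

    middleTerm : (ℕ → Carrier → Carrier) → ℕ → Carrier → ℕ → Carrier
    middleTerm A n t i = ((1# + t ^ 2 * q ^ (2 ℕ.* i ℕ.+ 1)) * (n C i) · A i t) * A (n ∸ i) (t * q ^ (i ℕ.+ 1))

    recurrenceRHS : (ℕ → Carrier → Carrier) → ℕ → Carrier → Carrier
    recurrenceRHS A n t = ((1# + t * q) * A n (t * q)) + (((1# + t * q ^ n) * A n t) + sumFrom1 R n (middleTerm A n t))

    recurrenceRHS-cong : ∀ {A B} → (∀ k t → A k t ≈ B k t) → ∀ n t → recurrenceRHS A n t ≈ recurrenceRHS B n t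
    recurrenceRHS-cong {A} {B} A≈B n t = +-cong (*-congˡ (A≈B n (t * q))) (+-cong (*-congˡ (A≈B n t)) (begin
      sumR R (map (middleTerm A n t) is)  ≡⟨ sumR-map is (middleTerm A n t) ⟩
      ∑ is (middleTerm A n t)
        ≈⟨ ∑-cong is (λ i → *-cong (*-congˡ (·-congʳ (n C i) (A≈B i t))) (A≈B (n ∸ i) _)) ⟩
      ∑ is (middleTerm B n t)             ≡⟨ sumR-map is (middleTerm B n t) ⟨
      sumR R (map (middleTerm B n t) is)  ∎))
      where is = drop 1 (upTo n)

    sumFrom1-suc : ∀ n f → sumFrom1 R (suc n) f ≡ ∑< n (f ∘ suc)
    sumFrom1-suc n f = ≡.trans (sumR-map (applyUpTo suc n) f) (∑-applyUpTo suc n f)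

    minimumTerm-first : ∀ n t → (suc n C 0) · minimumTerm t (suc n) 0 ≈ (1# + t * q) * Â 0 (suc n) (t * q)
    minimumTerm-first n t = begin
      1 · ((neighbours t 0 N * Â 0 0 t) * Â 0 N (t * q ^ 1))  ≈⟨ ·-homo-1 _ ⟩
      (neighbours t 0 N * Â 0 0 t) * Â 0 N (t * q ^ 1)
        ≈⟨ *-cong (*-cong (neighbours-first t n) (Â-zero 0 t)) (Â-cong 0 N (*-congˡ (*-identityʳ q))) ⟩
      ((1# + t * q) * 1#) * Â 0 N (t * q)                      ≈⟨ *-congʳ (*-identityʳ _) ⟩
      (1# + t * q) * Â 0 N (t * q)                             ∎
      where N = suc n

    minimumTerm-last : ∀ n t → (suc n C suc n) · minimumTerm t (suc n) (suc n) ≈ (1# + t * q ^ suc n) * Â 0 (suc n) t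
    minimumTerm-last n t = begin
      (N C N) · ((neighbours t N (N ∸ N) * Â 0 N t) * Â 0 (N ∸ N) (t * q ^ suc N))
        ≡⟨ ≡.cong₂ (λ c l → c · ((neighbours t N l * Â 0 N t) * Â 0 l (t * q ^ suc N))) (nCn≡1 N) (ℕ.n∸n≡0 N) ⟩
      1 · ((neighbours t N 0 * Â 0 N t) * Â 0 0 (t * q ^ suc N))
        ≈⟨ trans (·-homo-1 _) (*-cong (*-congʳ (neighbours-last t n)) (Â-zero 0 (t * q ^ suc N))) ⟩
      ((1# + t * q ^ N) * Â 0 N t) * 1#  ≈⟨ *-identityʳ _ ⟩
      (1# + t * q ^ N) * Â 0 N t         ∎
      where N = suc n

    minimumTerm-middle : ∀ n t i → 0 < i → i < n → (n C i) · minimumTerm t n i ≈ middleTerm (Â 0) n t i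
    minimumTerm-middle n t (suc j) _ i<n = begin
      nCi · ((neighbours t i (n ∸ i) * Â 0 i t) * Â 0 (n ∸ i) (t * q ^ suc i))
        ≈⟨ ×-assoc-* nCi _ _ ⟨
      (nCi · (neighbours t i (n ∸ i) * Â 0 i t)) * Â 0 (n ∸ i) (t * q ^ suc i)
        ≈⟨ *-congʳ (×-comm-* nCi _ _) ⟨
      (neighbours t i (n ∸ i) * nCi · Â 0 i t) * Â 0 (n ∸ i) (t * q ^ suc i)
        ≈⟨ *-congʳ (*-congʳ (neighbours-inner (n ∸ i) (ℕ.m<n⇒0<n∸m i<n))) ⟩
      (V * nCi · Â 0 i t) * Â 0 (n ∸ i) (t * q ^ suc i)
        ≡⟨ ≡.cong (λ k → (V * nCi · Â 0 i t) * Â 0 (n ∸ i) (t * q ^ k)) (ℕ.+-comm 1 i) ⟩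
      middleTerm (Â 0) n t i ∎
      where
      i = suc j
      nCi = n C i
      V = 1# + t ^ 2 * q ^ (2 ℕ.* i ℕ.+ 1)
      neighbours-inner : ∀ l → 0 < l → neighbours t i l ≈ V
      neighbours-inner (suc l) _ = neighbours-middle t j l

    Â-recurrence : ∀ n t → 2 · Â 0 (suc (suc n)) t ≈ recurrenceRHS (Â 0) (suc n) t
    Â-recurrence n t = begin
      2 · Â 0 (suc N) t
        ≈⟨ twice-Â-suc N t ⟩
      g 0 + ∑< (suc n) (g ∘ suc)
        ≈⟨ +-congˡ (trans (∑<-suc n (g ∘ suc)) (+-comm _ _)) ⟩
      g 0 + (g N + ∑< n (g ∘ suc))
        ≈⟨ +-cong (minimumTerm-first n t) (+-cong (minimumTerm-last n t)
             (∑<-cong n (λ j j<n → minimumTerm-middle N t (suc j) ℕ.z<s (ℕ.s≤s j<n)))) ⟩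
      (1# + t * q) * Â 0 N (t * q) + ((1# + t * q ^ N) * Â 0 N t + ∑< n (middleTerm (Â 0) N t ∘ suc))
        ≡⟨ ≡.cong (λ x → (1# + t * q) * Â 0 N (t * q) + ((1# + t * q ^ N) * Â 0 N t + x))
                  (sumFrom1-suc n (middleTerm (Â 0) N t)) ⟨
      recurrenceRHS (Â 0) N t ∎
      where
      N = suc n
      g : ℕ → Carrier
      g i = (N C i) · minimumTerm t N i

module _ {c ℓ} (R : CommutativeSemiring c ℓ) where
  open CommutativeSemiring R
  open import Algebra.Definitions.RawSemiring rawSemiring using (_^_)
  open import Algebra.Properties.Semiring.Exp semiring using (^-homo-*)
  open import Algebra.Properties.CommutativeSemigroup *-commutativeSemigroup using () renaming (interchange to *-interchange)
  open import Algebra.Properties.Monoid.Mult +-monoid using () renaming (×-congʳ to ·-congʳ)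
  open ListSum +-commutativeMonoid
  open AlternatingDescents R
  open import Relation.Binary.Reasoning.Setoid setoid

  altD-weight : ∀ q t i {n} (π : List (Fin n)) →
    t ^ length (altD i π) * q ^ ℕ.sum (altD i π) ≈ weight q 0 t i (map toℕ π)
  altD-weight q t i (a ∷ b ∷ π) = prepend (altCond i a b) (altD-weight q t (suc i) (b ∷ π))
    where
    D = altD (suc i) (b ∷ π)
    prepend : ∀ d {x} → t ^ length D * q ^ ℕ.sum D ≈ x →
      t ^ length ((if d then [ i ] else []) ++ D) * q ^ ℕ.sum ((if d then [ i ] else []) ++ D) ≈ mark q d t i * x
    prepend true  D≈x = trans (*-congˡ (^-homo-* q i (ℕ.sum D))) (trans (*-interchange t _ _ _) (*-congˡ D≈x))
    prepend false D≈x = trans D≈x (sym (*-identityˡ _))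
  altD-weight q t i []          = *-identityˡ 1#
  altD-weight q t i (a ∷ [])    = *-identityˡ 1#

  Ahat≈Â : ∀ n t q → Ahat R n t q ≈ Â q 0 n t
  Ahat≈Â n t q = begin
    sumR R (map (λ π → t ^ altdes π * q ^ altmaj π) (perms n))
      ≡⟨ sumR-map (perms n) _ ⟩
    ∑ (perms n) (λ π → t ^ altdes π * q ^ altmaj π)
      ≈⟨ ∑-cong (perms n) (altD-weight q t 1) ⟩
    ∑ (perms n) (weight q 0 t 1 ∘ map toℕ)
      ≡⟨ ≡.cong (λ ws → ∑ ws (weight q 0 t 1 ∘ map toℕ)) (perms-arrangements n) ⟩
    ∑ (arrangements n (allFin n)) (weight q 0 t 1 ∘ map toℕ)
      ≡⟨ Â-allFin q 0 n t ⟨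
    Â q 0 n t ∎

  Ahat-recurrence : ∀ n t q →
    natMul R 2 (Ahat R (suc (suc n)) t q) ≈ recurrenceRHS q (λ k t′ → Ahat R k t′ q) (suc n) t
  Ahat-recurrence n t q = begin
    natMul R 2 (Ahat R (suc (suc n)) t q)        ≈⟨ ·-congʳ 2 (Ahat≈Â (suc (suc n)) t q) ⟩
    natMul R 2 (Â q 0 (suc (suc n)) t)           ≈⟨ Â-recurrence q n t ⟩
    recurrenceRHS q (Â q 0) (suc n) t            ≈⟨ recurrenceRHS-cong q (λ k t′ → sym (Ahat≈Â k t′ q)) (suc n) t ⟩
    recurrenceRHS q (λ k t′ → Ahat R k t′ q) (suc n) t ∎

theorem2p2 : ∀ {c ℓ} (R : CommutativeSemiring c ℓ) →
    let open CommutativeSemiring R in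
    ((t q : Carrier) → Ahat R 1 t q ≈ 1#) ×
    ((n : ℕ) → 1 ≤ n → (t q : Carrier) →
      natMul R 2 (Ahat R (suc n) t q)
        ≈ ((1# + (t * q)) * Ahat R n (t * q) q)
          + (((1# + (t * powR R q n)) * Ahat R n t q)
          + sumFrom1 R n (λ i →
              ((1# + (powR R t 2 * powR R q ((2 ℕ.* i) ℕ.+ 1)))
                * natMul R (n C i) (Ahat R i t q))
                * Ahat R (n ℕ.∸ i) (t * powR R q (i ℕ.+ 1)) q)))
theorem2p2 R = (λ t q → trans (Ahat≈Â R 1 t q) (+-identityʳ 1#)) , λ { (suc n) _ → Ahat-recurrence R n }
  where open CommutativeSemiring R
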